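{- Let $G=(V,E)$ be a finite undirected graph and $T$ a rooted spanning tree of $G$ with root $r_T$. Let $S=\{x_1,\dots,x_k\}\subset V\setminus\{r_T\}$ with $|S|=k\ge3$. Suppose: (1) there exist distinct $x,y\in S$ with $x^{\downarrow T}\cap y^{\downarrow T}\neq\emptyset$; (2) for every $x'\in S$ there exists $y'\in S$ with $y'\notin x'^{\downarrow T}$. Then there is some $a\in S$ such that $\gamma(x_1^{\downarrow T},\dots,x_k^{\downarrow T})=\gamma(y_1^{\downarrow T},\dots,y_{k-1}^{\downarrow T})$, where $\{y_1,\dots,y_{k-1}\}=S\setminus\{a\}$.
   Context: $v^{\downarrow T}$ is the set of descendants of $v$ in $T$, including $v$. For $B\subseteq V$, $\delta(B)$ is the set of edges of $G$ with exactly one endpoint in $B$. For vertex sets $A_1,\dots,A_i\subseteq V$, $\gamma(A_1,\dots,A_i)=|\delta(A_1)\cap\cdots\cap\delta(A_i)|$. -}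

module Defs where

open import Data.Nat using (ℕ; zero; suc; _≤_)
open import Data.Fin using (Fin; _<_; _≟_)
open import Data.Fin.Properties using (_<?_)
open import Data.Bool using (Bool; true; false; _xor_; _∧_; not; if_then_else_)
open import Data.List using (List; []; _∷_; map; filter; allFin; concatMap; length)
open import Data.Bool.ListAction using (any; all)
open import Data.Product using (Σ; _×_; ∃; ∃-syntax)
open import Relation.Binary.PropositionalEquality using (_≡_; _≢_)
open import Relation.Nullary using (¬_; does)

record Graph (n : ℕ) : Set where
  field
    adj   : Fin n → Fin n → Bool
    sym   : ∀ u v → adj u v ≡ adj v u
    irrefl : ∀ v → adj v v ≡ false
open Graph public

iter : {A : Set} → (A → A) → ℕ → A → A
iter f zero    a = a
iter f (suc k) a = f (iter f k a)

-- The tree edges are {v , parent v} for v ≢ root; they must be edges of G,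
-- and every vertex reaches the root by following parents (so no cycles and
-- the tree spans/connects all vertices).
record RootedSpanningTree {n : ℕ} (G : Graph n) : Set where
  field
    root       : Fin n
    parent     : Fin n → Fin n
    parent-root : parent root ≡ root
    tree-edge  : ∀ v → v ≢ root → adj G v (parent v) ≡ true
    reaches-root : ∀ v → ∃[ k ] iter parent k v ≡ root
open RootedSpanningTree public

VSet : ℕ → Set
VSet n = Fin n → Bool

-- v^{↓T}: descendants of v in T (including v): the vertices w whose
-- ancestor chain w, parent w, parent² w, ... contains v.  Since the tree has
-- n vertices, it suffices to look at the first n steps of the chain.
desc : {n : ℕ} {G : Graph n} → RootedSpanningTree G → Fin n → VSet n
desc {n} T v w = any (λ i → does (iter (parent T) (Data.Fin.toℕ i) w ≟ v)) (allFin n)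

crosses : {n : ℕ} → VSet n → Fin n → Fin n → Bool
crosses B u w = B u xor B w

edges : {n : ℕ} → Graph n → List (Fin n × Fin n)
edges {n} G = concatMap (λ u → map (λ w → (u Data.Product., w))
                 (filter (λ w → u <? w) (filter (λ w → Data.Bool.T? (adj G u w)) (allFin n))))
               (allFin n)

γ : {n : ℕ} → Graph n → List (VSet n) → ℕ
γ G As = length (filter (λ e → Data.Bool.T? (all (λ B → crosses B (Data.Product.proj₁ e) (Data.Product.proj₂ e)) As)) (edges G))

-- Descendant sets in a rooted tree form a laminar family: two of them are either disjoint
-- or nested.  By (1) there are q ≠ p with x_q^↓ ⊆ x_p^↓, and by (2) some x_y lies outside
-- x_p^↓, so x_p^↓ ⊆ x_y^↓ as soon as the two meet.  An edge in δ(x_i^↓) for all i ≠ p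
-- leaves x_q^↓, hence has an endpoint in x_p^↓, and leaves x_y^↓, hence does not have both
-- endpoints in x_p^↓; so it lies in δ(x_p^↓) too, and dropping a = x_p does not change γ.
module Submission where

open import Defs
open import Data.Nat using (ℕ; _≥_)
open import Data.Fin using (Fin; _≟_)
open import Data.Bool using (true; false)
open import Data.List using (map; filter; allFin)
open import Data.Product using (Σ; _×_; ∃; ∃-syntax)
open import Function.Definitions using (Injective)
open import Relation.Binary.PropositionalEquality using (_≡_; _≢_)
open import Relation.Nullary using (¬_; ¬?)

open import Data.Nat using (zero; suc; _+_; _∸_; _≤_; _<_; _<?_; s≤s⁻¹)
open import Data.Nat.Properties
  using (≤-total; ≤-trans; ≤-reflexive; <-≤-trans; ≮⇒≥; n<1+n; m∸n+n≡m; +-monoʳ-<)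
open import Data.Nat.Induction using (<-rec)
open import Data.Fin using (toℕ; fromℕ<)
open import Data.Fin.Properties using (pigeonhole; toℕ<n; toℕ-fromℕ<)
open import Data.Bool using (Bool; T; T?; _xor_)
open import Data.Bool.Properties using (T-≡)
open import Data.Bool.ListAction using (any; all)
open import Data.List using (List; length)
open import Data.List.Properties using (filter-≐)
open import Data.List.Membership.Propositional using (lose)
open import Data.List.Membership.Propositional.Properties using (∈-allFin; ∈-filter⁺; ∈-filter⁻)
open import Data.List.Relation.Unary.All using (tabulate; lookup)
open import Data.List.Relation.Unary.All.Properties using (all⁺; all⁻; map⁺; map⁻)
open import Data.List.Relation.Unary.Any using (satisfied)
open import Data.List.Relation.Unary.Any.Properties using (any⁺; any⁻)
open import Data.Product using (_,_; proj₂)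
open import Data.Sum using (_⊎_; inj₁; inj₂; [_,_]′)
open import Data.Empty using (⊥)
open import Function using (_∘_; _⇔_; mk⇔; Equivalence)
open import Relation.Nullary using (Dec; does; yes; no; contradiction)
open import Relation.Binary.PropositionalEquality using (refl; trans; cong; subst; module ≡-Reasoning)
  renaming (sym to ≡-sym)

open Equivalence using (to; from)

T-does : {P : Set} (p? : Dec P) → T (does p?) ⇔ P
T-does (yes p) = mk⇔ (λ _ → p) (λ _ → _)
T-does (no ¬p) = mk⇔ (λ ()) ¬p

module _ {A : Set} (f : A → A) where
  open ≡-Reasoning

  iter-+ : ∀ m l a → iter f (m + l) a ≡ iter f m (iter f l a)
  iter-+ zero    l a = refl
  iter-+ (suc m) l a = cong f (iter-+ m l a)

  iter-∸ : ∀ {m l} a → m ≤ l → iter f (l ∸ m) (iter f m a) ≡ iter f l a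
  iter-∸ {m} {l} a m≤l = begin
    iter f (l ∸ m) (iter f m a) ≡⟨ ≡-sym (iter-+ (l ∸ m) m a) ⟩
    iter f (l ∸ m + m) a        ≡⟨ cong (λ t → iter f t a) (m∸n+n≡m m≤l) ⟩
    iter f l a                  ∎

  iter-shift : ∀ {i j a} → iter f i a ≡ iter f j a → ∀ r → iter f (r + i) a ≡ iter f (r + j) a
  iter-shift {i} {j} {a} eq r = begin
    iter f (r + i) a      ≡⟨ iter-+ r i a ⟩
    iter f r (iter f i a) ≡⟨ cong (iter f r) eq ⟩
    iter f r (iter f j a) ≡⟨ ≡-sym (iter-+ r j a) ⟩
    iter f (r + j) a      ∎

  Reaches : A → A → Set
  Reaches a b = ∃[ m ] iter f m a ≡ b

  Reaches-refl : ∀ a → Reaches a a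
  Reaches-refl a = 0 , refl

  Reaches-trans : ∀ {a b c} → Reaches a b → Reaches b c → Reaches a c
  Reaches-trans {a} (m , refl) (l , refl) = l + m , iter-+ l m a

  Reaches-total : ∀ {a b c} → Reaches a b → Reaches a c → Reaches b c ⊎ Reaches c b
  Reaches-total {a} (m , refl) (l , refl) with ≤-total m l
  ... | inj₁ m≤l = inj₁ (l ∸ m , iter-∸ a m≤l)
  ... | inj₂ l≤m = inj₂ (m ∸ l , iter-∸ a l≤m)

module _ {n : ℕ} (f : Fin n → Fin n) where

  orbit-repeats : ∀ a → ∃[ i ] ∃[ j ] i < j × j ≤ n × iter f i a ≡ iter f j a
  orbit-repeats a with pigeonhole (n<1+n n) (λ i → iter f (toℕ i) a)
  ... | i , j , i<j , eq = toℕ i , toℕ j , i<j , s≤s⁻¹ (toℕ<n j) , eq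

  -- An iterate reached after m ≥ n steps is reached after fewer: cut out a cycle of the orbit.
  Reaches-within : ∀ {a b} → Reaches f a b → ∃[ m ] m < n × iter f m a ≡ b
  Reaches-within {a} {b} (m , eq) = <-rec P shorten m eq
    where
    P : ℕ → Set
    P m = iter f m a ≡ b → ∃[ m' ] m' < n × iter f m' a ≡ b

    shorten : ∀ m → (∀ {l} → l < m → P l) → P m
    shorten m rec eq with m <? n
    ... | yes m<n = m , m<n , eq
    ... | no m≮n with orbit-repeats a
    ... | i , j , i<j , j≤n , cycle = rec shorter (trans (iter-shift f cycle (m ∸ j)) eq′)
      where
      j≤m : j ≤ m
      j≤m = ≤-trans j≤n (≮⇒≥ m≮n)
      shorter : m ∸ j + i < m
      shorter = <-≤-trans (+-monoʳ-< (m ∸ j) i<j) (≤-reflexive (m∸n+n≡m j≤m))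
      eq′ : iter f (m ∸ j + j) a ≡ b
      eq′ = trans (cong (λ t → iter f t a) (m∸n+n≡m j≤m)) eq

_∈ᵥ_ : ∀ {n} → Fin n → VSet n → Set
w ∈ᵥ A = T (A w)

_⊆ᵥ_ : ∀ {n} → VSet n → VSet n → Set
A ⊆ᵥ B = ∀ {w} → w ∈ᵥ A → w ∈ᵥ B

≡true⇒∈ᵥ : ∀ {n} (A : VSet n) {w} → A w ≡ true → w ∈ᵥ A
≡true⇒∈ᵥ A = from T-≡

≡false⇒∉ᵥ : ∀ {n} (A : VSet n) {w} → A w ≡ false → ¬ w ∈ᵥ A
≡false⇒∉ᵥ A eq = subst T eq

module _ {n : ℕ} {G : Graph n} (τ : RootedSpanningTree G) where

  desc⇔Reaches : ∀ {v w} → w ∈ᵥ desc τ v ⇔ Reaches (parent τ) w v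
  desc⇔Reaches {v} {w} = mk⇔ toReaches fromReaches
    where
    toReaches : w ∈ᵥ desc τ v → Reaches (parent τ) w v
    toReaches w∈ with satisfied (any⁻ _ (allFin n) w∈)
    ... | i , hit = toℕ i , to (T-does (iter (parent τ) (toℕ i) w ≟ v)) hit

    fromReaches : Reaches (parent τ) w v → w ∈ᵥ desc τ v
    fromReaches r with Reaches-within (parent τ) r
    ... | m , m<n , eq =
      any⁺ _ (lose (∈-allFin i) (from (T-does (iter (parent τ) (toℕ i) w ≟ v)) hit))
      where
      i : Fin n
      i = fromℕ< m<n
      hit : iter (parent τ) (toℕ i) w ≡ v
      hit = subst (λ t → iter (parent τ) t w ≡ v) (≡-sym (toℕ-fromℕ< m<n)) eq

  desc-refl : ∀ v → v ∈ᵥ desc τ v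
  desc-refl v = from desc⇔Reaches (Reaches-refl (parent τ) v)

  desc-⊆ : ∀ {u v} → u ∈ᵥ desc τ v → desc τ u ⊆ᵥ desc τ v
  desc-⊆ u∈ w∈ = from desc⇔Reaches
    (Reaches-trans (parent τ) (to desc⇔Reaches w∈) (to desc⇔Reaches u∈))

  desc-nested : ∀ {u v w} → w ∈ᵥ desc τ u → w ∈ᵥ desc τ v →
                desc τ u ⊆ᵥ desc τ v ⊎ desc τ v ⊆ᵥ desc τ u
  desc-nested w∈u w∈v with Reaches-total (parent τ) (to desc⇔Reaches w∈u) (to desc⇔Reaches w∈v)
  ... | inj₁ u↝v = inj₁ (desc-⊆ (from desc⇔Reaches u↝v))
  ... | inj₂ v↝u = inj₂ (desc-⊆ (from desc⇔Reaches v↝u))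

  desc-⊆-if-meets : ∀ {u v w} → ¬ v ∈ᵥ desc τ u → w ∈ᵥ desc τ u → w ∈ᵥ desc τ v →
                    desc τ u ⊆ᵥ desc τ v
  desc-⊆-if-meets {v = v} v∉ w∈u w∈v with desc-nested w∈u w∈v
  ... | inj₁ u⊆v = u⊆v
  ... | inj₂ v⊆u = contradiction (v⊆u (desc-refl v)) v∉

T-xor⁻ : ∀ a b → T (a xor b) → T a ⊎ T b
T-xor⁻ true  b _ = inj₁ _
T-xor⁻ false b t = inj₂ t

T-xor-both : ∀ a b → T (a xor b) → T a → T b → ⊥
T-xor-both true true ()

T-xor⁺ : ∀ a b → T a ⊎ T b → ¬ (T a × T b) → T (a xor b)
T-xor⁺ true  false _ _ = _
T-xor⁺ false true  _ _ = _
T-xor⁺ true  true  _ ¬both = ¬both (_ , _)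
T-xor⁺ false false (inj₁ ())
T-xor⁺ false false (inj₂ ())

crosses-of-nested : ∀ {n} {A B C : VSet n} {u v} → B ⊆ᵥ A →
                    (∀ {w} → w ∈ᵥ A → w ∈ᵥ C → A ⊆ᵥ C) →
                    T (crosses B u v) → T (crosses C u v) → T (crosses A u v)
crosses-of-nested {A = A} {B} {C} {u} {v} B⊆A A⊆C-if-meets B-crossed C-crossed =
  T-xor⁺ (A u) (A v) some-endpoint-in-A not-both-in-A
  where
  some-endpoint-in-A : u ∈ᵥ A ⊎ v ∈ᵥ A
  some-endpoint-in-A with T-xor⁻ (B u) (B v) B-crossed
  ... | inj₁ u∈B = inj₁ (B⊆A u∈B)
  ... | inj₂ v∈B = inj₂ (B⊆A v∈B)

  not-both-in-A : ¬ (u ∈ᵥ A × v ∈ᵥ A)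
  not-both-in-A (u∈A , v∈A) with T-xor⁻ (C u) (C v) C-crossed
  ... | inj₁ u∈C = T-xor-both (C u) (C v) C-crossed u∈C (A⊆C-if-meets u∈A u∈C v∈A)
  ... | inj₂ v∈C = T-xor-both (C u) (C v) C-crossed (A⊆C-if-meets v∈A v∈C u∈A) v∈C

crossesAll : ∀ {n} → List (VSet n) → Fin n → Fin n → Bool
crossesAll As u v = all (λ B → crosses B u v) As

γ-cong : ∀ {n} (G : Graph n) {As Bs : List (VSet n)} →
         (∀ {u v} → T (crossesAll As u v) → T (crossesAll Bs u v)) →
         (∀ {u v} → T (crossesAll Bs u v) → T (crossesAll As u v)) →
         γ G As ≡ γ G Bs
γ-cong G As⇒Bs Bs⇒As =
  cong length (filter-≐ (λ _ → T? _) (λ _ → T? _) (As⇒Bs , Bs⇒As) (edges G))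

module _ {A : Set} (h : A → Bool) {k : ℕ} (f : Fin k → A) where

  all-map-allFin : T (all h (map f (allFin k))) ⇔ (∀ i → T (h (f i)))
  all-map-allFin = mk⇔
    (λ t i → lookup (map⁻ (all⁺ h _ t)) (∈-allFin i))
    (λ H → all⁻ h {map f (allFin k)} (map⁺ (tabulate (λ {i} _ → H i))))

  all-map-allFin-except : ∀ p →
    T (all h (map f (filter (λ i → ¬? (i ≟ p)) (allFin k)))) ⇔ (∀ i → i ≢ p → T (h (f i)))
  all-map-allFin-except p = mk⇔
    (λ t i i≢p → lookup (map⁻ (all⁺ h _ t)) (∈-filter⁺ ≢p? (∈-allFin i) i≢p))
    (λ H → all⁻ h {map f others}
             (map⁺ (tabulate (λ i∈ → H _ (proj₂ (∈-filter⁻ ≢p? {xs = allFin k} i∈))))))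
    where
    ≢p? : ∀ i → Dec (i ≢ p)
    ≢p? i = ¬? (i ≟ p)
    others : List (Fin k)
    others = filter ≢p? (allFin k)

γ-drop : ∀ {n k} (G : Graph n) (D : Fin k → VSet n) {p q y : Fin k} →
         q ≢ p → y ≢ p → D q ⊆ᵥ D p →
         (∀ {w} → w ∈ᵥ D p → w ∈ᵥ D y → D p ⊆ᵥ D y) →
         γ G (map D (allFin k)) ≡ γ G (map D (filter (λ i → ¬? (i ≟ p)) (allFin k)))
γ-drop {n} {k} G D {p} {q} {y} q≢p y≢p Dq⊆Dp Dp⊆Dy-if-meets =
  γ-cong G {all-sets} {other-sets} all⇒others others⇒all
  where
  all-sets other-sets : List (VSet n)
  all-sets   = map D (allFin k)
  other-sets = map D (filter (λ i → ¬? (i ≟ p)) (allFin k))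

  all⇒others : ∀ {u v} → T (crossesAll all-sets u v) → T (crossesAll other-sets u v)
  all⇒others t = from (all-map-allFin-except _ D p) (λ i _ → to (all-map-allFin _ D) t i)

  others⇒all : ∀ {u v} → T (crossesAll other-sets u v) → T (crossesAll all-sets u v)
  others⇒all {u} {v} t = from (all-map-allFin _ D) crosses-each
    where
    crosses-other : ∀ i → i ≢ p → T (crosses (D i) u v)
    crosses-other = to (all-map-allFin-except _ D p) t

    crosses-each : ∀ i → T (crosses (D i) u v)
    crosses-each i with i ≟ p
    ... | yes refl = crosses-of-nested Dq⊆Dp Dp⊆Dy-if-meets
                       (crosses-other q q≢p) (crosses-other y y≢p)
    ... | no i≢p   = crosses-other i i≢p

proposition4p7 : (n : ℕ) (G : Graph n) (T : RootedSpanningTree G)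
    (k : ℕ) (x : Fin k → Fin n) → Injective _≡_ _≡_ x → k ≥ 3
    → (∀ i → x i ≢ root T)
    → (∃[ i ] ∃[ j ] (i ≢ j × ∃[ w ] (desc T (x i) w ≡ true × desc T (x j) w ≡ true)))
    → (∀ i → ∃[ j ] desc T (x i) (x j) ≡ false)
    → ∃[ a ] γ G (map (λ i → desc T (x i)) (allFin k))
             ≡ γ G (map (λ i → desc T (x i)) (filter (λ i → ¬? (i ≟ a)) (allFin k)))
proposition4p7 n G T k x _ _ _ (i , j , i≢j , w , w∈Di , w∈Dj) escapes =
  [ drop-outer i≢j , drop-outer (i≢j ∘ ≡-sym) ]′
    (desc-nested T (≡true⇒∈ᵥ (D i) w∈Di) (≡true⇒∈ᵥ (D j) w∈Dj))
  where
  D : Fin k → VSet n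
  D i = desc T (x i)

  drop-outer : ∀ {p q} → q ≢ p → D q ⊆ᵥ D p →
               ∃[ a ] γ G (map D (allFin k)) ≡ γ G (map D (filter (λ i → ¬? (i ≟ a)) (allFin k)))
  drop-outer {p} q≢p Dq⊆Dp with escapes p
  ... | y , xy∉Dp =
    p , γ-drop G D q≢p y≢p Dq⊆Dp (desc-⊆-if-meets T (≡false⇒∉ᵥ (D p) xy∉Dp))
    where
    y≢p : y ≢ p
    y≢p refl = ≡false⇒∉ᵥ (D p) xy∉Dp (desc-refl T (x p))
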